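{- As $n\to\infty$, \[\operatorname{ldim}(Q_n)\ \ge\ \operatorname{ldim}\big(Q_n^{1,\lfloor n/2\rfloor}\big)\ \ge\ \frac{n}{\log n}-O\!\left(\frac{n\log\log n}{(\log n)^2}\right).\]
   Context: Logarithms are base 2. $Q_n$ is the Boolean lattice of all subsets of $[n]$ ordered by inclusion, and $Q_n^{1,\lfloor n/2\rfloor}$ is its suborder consisting of the 1-element and the $\lfloor n/2\rfloor$-element subsets. For a poset $P=(X,\le)$, a partial linear extension is a linear order $L=(Y,\le_L)$ with $Y\subseteq X$ such that $x\le y$ implies $x\le_L y$ for $x,y\in Y$. A local realiser is a set $\mathcal{L}$ of partial linear extensions such that for every ordered pair $(x,y)$ with $x\not\ge y$ some $L\in\mathcal{L}$ contains both and has $x\le_L y$. The multiplicity $\mu_{\mathcal{L}}(x)$ is the number of members of $\mathcal{L}$ containing $x$; the local dimension $\operatorname{ldim}(P)$ is the minimum over local realisers of $\max_x\mu_{\mathcal{L}}(x)$. -}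

module Defs where

open import Data.Nat using (ℕ; _≤_; _+_; _*_; ⌊_/2⌋)
open import Data.Nat.Logarithm using (⌊log₂_⌋)
open import Data.Bool using (Bool)
import Data.Bool.Properties as BoolP
open import Data.Vec.Properties using (≡-dec)
open import Data.Fin.Subset using (Subset; _⊆_; ∣_∣)
open import Data.List using (List; []; _∷_; _++_; length; filter)
open import Data.List.Relation.Unary.All using (All)
open import Data.List.Relation.Unary.Unique.Propositional using (Unique)
open import Data.List.Membership.Propositional using (_∈_)
import Data.List.Membership.DecPropositional as DecMem
open import Data.Product using (Σ; ∃; _×_; ∃-syntax)
open import Data.Sum using (_⊎_)
open import Data.Unit using (⊤)
open import Relation.Nullary using (¬_)
open import Relation.Binary.Definitions using (DecidableEquality)
open import Relation.Binary.PropositionalEquality using (_≡_)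

-- A finite poset presented as a ground set X ⊆ A (predicate `X`) of a
-- type A with decidable equality, with order relation `_≼_` (restricted to X).
module LocalDim {A : Set} (_≟_ : DecidableEquality A)
                (X : A → Set) (_≼_ : A → A → Set) where

  open DecMem _≟_ using (_∈?_)

  -- x ≤_L y : in the list L (a linear order, earlier = smaller), x occurs
  -- and y occurs at or after x.
  _≤[_]_ : A → List A → A → Set
  x ≤[ L ] y = ∃[ P ] ∃[ S ] (L ≡ P ++ (x ∷ S) × y ∈ (x ∷ S))

  -- partial linear extension: a linear order on a subset Y of X
  -- (given as a duplicate-free list) respecting the order of P.
  record PartialLinExt (L : List A) : Set where
    field
      inX     : All X L
      unique  : Unique L
      respects : ∀ x y → x ∈ L → y ∈ L → x ≼ y → x ≤[ L ] y

  record LocalRealiser (ℒ : List (List A)) : Set where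
    field
      ples  : All PartialLinExt ℒ
      covers : ∀ x y → X x → X y → ¬ (y ≼ x) →
               ∃[ L ] (L ∈ ℒ × x ∈ L × y ∈ L × x ≤[ L ] y)

  μ : List (List A) → A → ℕ
  μ ℒ x = length (filter (x ∈?_) ℒ)

  LdimAtMost : ℕ → Set
  LdimAtMost k = ∃[ ℒ ] (LocalRealiser ℒ × (∀ x → X x → μ ℒ x ≤ k))

  LdimAtLeast : ℕ → Set
  LdimAtLeast m = ∀ k → LdimAtMost k → m ≤ k

_≟S_ : ∀ {n} → DecidableEquality (Subset n)
_≟S_ = ≡-dec BoolP._≟_

AllSubsets : ∀ {n} → Subset n → Set
AllSubsets _ = ⊤

Levels1Half : ∀ {n} → Subset n → Set
Levels1Half {n} s = ∣ s ∣ ≡ 1 ⊎ ∣ s ∣ ≡ ⌊ n /2⌋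

-- ldim(Q_n) ≥ ldim(Q_n^{1,⌊n/2⌋}), expressed as: every value k that
-- bounds ldim(Q_n) from above also bounds ldim(Q_n^{1,⌊n/2⌋}) from above
ldimQn≤k : ℕ → ℕ → Set
ldimQn≤k n k = LocalDim.LdimAtMost (_≟S_ {n}) AllSubsets _⊆_ k

ldimQn1half≤k : ℕ → ℕ → Set
ldimQn1half≤k n k = LocalDim.LdimAtMost (_≟S_ {n}) Levels1Half _⊆_ k

-- The first inequality is monotonicity of local dimension under induced subposets:
-- restricting every partial linear extension of a local realiser to the smaller ground
-- set yields a local realiser whose multiplicities are no larger (module Restriction).
--
-- For the second, let ℒ be a local realiser of Q_n^{1,m}, m = ⌊n/2⌋, with multiplicities
-- at most k. Encode an m-set S by the tuple, over L ∈ ℒ, of the singletons following S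
-- in L. These are exactly the ⁅ i ⁆ with i ∉ S, so the code determines S; each entry is a
-- suffix of the singleton part of L (of length w_L), at most k entries are nonempty, and
-- Σ w_L ≤ k·n by double counting (module MiddleLevelEncoding). Counting such tuples,
--   C(n, m) ≤ sparseCount w k ≤ (Σ w + k)^k / k! ≤ (8(n+1))^k      (using k^k ≤ 8^k·k!),
-- and with 2^n ≤ (n+1)·C(n, m) this gives n ≤ ℓ + 1 + (ℓ + 4)·k for ℓ = ⌊log₂ n⌋, which
-- rearranges to the stated bound with C = 6 and N = 4 (module Estimates).
module Submission where

open import Defs
open import Data.Nat using (ℕ; _≤_; _+_; _*_)
open import Data.Nat.Logarithm using (⌊log₂_⌋)
open import Data.Product using (_×_; ∃-syntax)

open import Data.Nat using (zero; suc; _<_; _^_; _!; _∸_; ⌊_/2⌋; ⌈_/2⌉; z≤n; s≤s; NonZero; ≢-nonZero)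
open import Data.Nat.Properties
open import Data.Nat.ListAction using (sum)
open import Data.Nat.Tactic.RingSolver using (solve-∀)
open import Data.List using (List; []; _∷_; _++_; length; filter; map; concat; concatMap; allFin)
import Data.List.Properties as List
open import Data.List.Relation.Unary.All using (All; []; _∷_)
import Data.List.Relation.Unary.All as All
import Data.List.Relation.Unary.All.Properties as All
open import Data.List.Relation.Unary.Any using (here; there; index; _─_)
open import Data.List.Relation.Unary.Unique.Propositional using (Unique; []; _∷_)
import Data.List.Relation.Unary.Unique.Propositional.Properties as Unique
open import Data.List.Membership.Propositional using (_∈_; _∉_)
open import Data.List.Membership.Propositional.Properties
  using (∈-++⁺ˡ; ∈-++⁺ʳ; ∈-map⁺; ∈-map⁻; ∈-filter⁺; ∈-filter⁻; ∈-concat⁺′; ∈-concat⁻′; ∈-allFin)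
open import Data.Product using (_,_; proj₁)
open import Data.Fin.Subset using (Subset; _⊆_; ∣_∣)
open import Data.Sum using (inj₁; inj₂)
open import Data.Empty using (⊥; ⊥-elim)
open import Data.Bool using (true; false)
open import Relation.Nullary using (¬_; Dec; yes; no; does; contradiction)
open import Relation.Nullary.Decidable using (_⊎-dec_)
open import Data.Unit using (tt)
open import Relation.Unary using (Pred; Decidable)
open import Relation.Binary.Definitions using (DecidableEquality)
open import Relation.Binary.PropositionalEquality using (_≡_; _≢_; refl; sym; trans; cong; cong₂; subst; module ≡-Reasoning)
open import Data.List.Relation.Binary.Pointwise using (Pointwise; []; _∷_)

count-map-≤ : ∀ {C B : Set} {p q} {P : Pred B p} {Q : Pred C q} (P? : Decidable P) (Q? : Decidable Q)
  (f : C → B) → (∀ a → P (f a) → Q a) → ∀ xs →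
  length (filter P? (map f xs)) ≤ length (filter Q? xs)
count-map-≤ P? Q? f P⇒Q [] = z≤n
count-map-≤ P? Q? f P⇒Q (a ∷ xs) with P? (f a) | Q? a
... | yes _   | yes _  = s≤s (count-map-≤ P? Q? f P⇒Q xs)
... | no _    | yes _  = m≤n⇒m≤1+n (count-map-≤ P? Q? f P⇒Q xs)
... | no _    | no _   = count-map-≤ P? Q? f P⇒Q xs
... | yes Pfa | no ¬Qa = ⊥-elim (¬Qa (P⇒Q a Pfa))

∈-─ : ∀ {C : Set} {x z : C} {ys : List C} (p : x ∈ ys) → z ∈ ys → z ≢ x → z ∈ (ys ─ p)
∈-─ (here refl) (here refl) z≢x = ⊥-elim (z≢x refl)
∈-─ (here refl) (there z∈)  _   = z∈
∈-─ (there p)   (here refl) _   = here refl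
∈-─ (there p)   (there z∈)  z≢x = there (∈-─ p z∈ z≢x)

module ListFacts {A : Set} where

  injection-length : ∀ {B : Set} {xs : List A} {ys : List B} (f : A → B) → Unique xs →
    (∀ {x} → x ∈ xs → f x ∈ ys) → (∀ {x y} → x ∈ xs → y ∈ xs → f x ≡ f y → x ≡ y) →
    length xs ≤ length ys
  injection-length f [] _ _ = z≤n
  injection-length {xs = x ∷ xs} {ys} f (x∉xs ∷ uniq) into inj = begin
      suc (length xs)          ≤⟨ s≤s (injection-length f uniq into′ inj′) ⟩
      suc (length (ys ─ fx∈))  ≡⟨ List.length-removeAt′ ys (index fx∈) ⟨
      length ys                ∎
    where
    open ≤-Reasoning
    fx∈ = into (here refl)
    into′ : ∀ {z} → z ∈ xs → f z ∈ (ys ─ fx∈)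
    into′ z∈ = ∈-─ fx∈ (into (there z∈))
      (λ fz≡fx → All.lookup x∉xs z∈ (inj (here refl) (there z∈) (sym fz≡fx)))
    inj′ : ∀ {y z} → y ∈ xs → z ∈ xs → f y ≡ f z → y ≡ z
    inj′ y∈ z∈ = inj (there y∈) (there z∈)

  _≤[_]_ : A → List A → A → Set
  x ≤[ L ] y = ∃[ P ] ∃[ S ] (L ≡ P ++ (x ∷ S) × y ∈ (x ∷ S))

  later-not-before : ∀ P {x y S} → Unique (P ++ x ∷ S) → y ∈ S → ¬ (y ≤[ P ++ x ∷ S ] x)
  later-not-before P uniq y∈S (P′ , S′ , eq , x∈) = go P P′ uniq eq y∈S x∈
    where
    go : ∀ P P′ {x y S S′} → Unique (P ++ x ∷ S) → P ++ x ∷ S ≡ P′ ++ y ∷ S′ →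
         y ∈ S → x ∈ y ∷ S′ → ⊥
    go []      []       (x∉ ∷ _) refl y∈S _   = All.All¬⇒¬Any x∉ y∈S
    go []      (_ ∷ P′) (x∉ ∷ _) refl _   x∈  = All.All¬⇒¬Any x∉ (∈-++⁺ʳ P′ x∈)
    go (_ ∷ P) []       (z∉ ∷ _) refl y∈S _   = All.All¬⇒¬Any z∉ (∈-++⁺ʳ P (there y∈S))
    go (_ ∷ P) (_ ∷ P′) (_ ∷ uniq) eq y∈S x∈  = go P P′ uniq (List.∷-injectiveʳ eq) y∈S x∈

  ≤-filter : ∀ {q} {Q : Pred A q} (Q? : Decidable Q) {x y L} → Q x → Q y →
             x ≤[ L ] y → x ≤[ filter Q? L ] y
  ≤-filter Q? {x} {y} Qx Qy (P , S , refl , y∈) =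
    filter Q? P , filter Q? S ,
    trans (List.filter-++ Q? P (x ∷ S)) (cong (filter Q? P ++_) (List.filter-accept Q? Qx)) ,
    kept y∈
    where
    kept : y ∈ x ∷ S → y ∈ x ∷ filter Q? S
    kept (here y≡x) = here y≡x
    kept (there y∈S) = there (∈-filter⁺ Q? y∈S Qy)

module Suffixes {A : Set} where

  data Suffix : List A → List A → Set where
    self : ∀ {xs} → Suffix xs xs
    skip : ∀ {xs y ys} → Suffix xs ys → Suffix xs (y ∷ ys)

  suffix-⊆ : ∀ {xs ys z} → Suffix xs ys → z ∈ xs → z ∈ ys
  suffix-⊆ self     z∈ = z∈
  suffix-⊆ (skip s) z∈ = there (suffix-⊆ s z∈)

  filter-suffix : ∀ {q} {Q : Pred A q} (Q? : Decidable Q) {xs ys} →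
                  Suffix xs ys → Suffix (filter Q? xs) (filter Q? ys)
  filter-suffix Q? self = self
  filter-suffix Q? {ys = y ∷ ys} (skip s) with does (Q? y)
  ... | true  = skip (filter-suffix Q? s)
  ... | false = filter-suffix Q? s

  nonemptySuffixes : List A → List (List A)
  nonemptySuffixes []       = []
  nonemptySuffixes (x ∷ xs) = (x ∷ xs) ∷ nonemptySuffixes xs

  length-nonemptySuffixes : ∀ xs → length (nonemptySuffixes xs) ≡ length xs
  length-nonemptySuffixes []       = refl
  length-nonemptySuffixes (x ∷ xs) = cong suc (length-nonemptySuffixes xs)

  suffix-nonempty : ∀ {y ys xs} → Suffix (y ∷ ys) xs → (y ∷ ys) ∈ nonemptySuffixes xs
  suffix-nonempty self = here refl
  suffix-nonempty {xs = _ ∷ []}    (skip ())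
  suffix-nonempty {xs = _ ∷ _ ∷ _} (skip s) = there (suffix-nonempty s)

module After {A : Set} (_≟_ : DecidableEquality A) where
  open ListFacts {A}
  open Suffixes {A}

  after : A → List A → List A
  after x []       = []
  after x (y ∷ ys) with x ≟ y
  ... | yes _ = ys
  ... | no _  = after x ys

  after-suffix : ∀ x L → Suffix (after x L) L
  after-suffix x []       = self
  after-suffix x (y ∷ L) with x ≟ y
  ... | yes _ = skip self
  ... | no _  = skip (after-suffix x L)

  after-∉ : ∀ {x} L → x ∉ L → after x L ≡ []
  after-∉ []      _   = refl
  after-∉ {x} (y ∷ L) x∉ with x ≟ y
  ... | yes refl = ⊥-elim (x∉ (here refl))
  ... | no _     = after-∉ L (λ x∈L → x∉ (there x∈L))

  after-split : ∀ {x y} L → y ∈ after x L → ∃[ P ] (L ≡ P ++ x ∷ after x L)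
  after-split {x} (z ∷ L) y∈ with x ≟ z
  ... | yes refl = [] , refl
  ... | no _ with after-split L y∈
  ...   | P , eq = z ∷ P , cong (z ∷_) eq

  after-unique : ∀ P {x S} → Unique (P ++ x ∷ S) → after x (P ++ x ∷ S) ≡ S
  after-unique [] {x} _ with x ≟ x
  ... | yes _  = refl
  ... | no x≢x = ⊥-elim (x≢x refl)
  after-unique (z ∷ P) {x} (z∉ ∷ uniq) with x ≟ z
  ... | yes refl = ⊥-elim (All.All¬⇒¬Any z∉ (∈-++⁺ʳ P (here refl)))
  ... | no _     = after-unique P uniq

module Sums where
  open import Algebra.Properties.CommutativeSemigroup +-commutativeSemigroup using (x∙yz≈y∙xz)

  sum-mono : ∀ {A : Set} (f g : A → ℕ) xs → (∀ {x} → x ∈ xs → f x ≤ g x) →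
             sum (map f xs) ≤ sum (map g xs)
  sum-mono f g []       _   = z≤n
  sum-mono f g (x ∷ xs) f≤g = +-mono-≤ (f≤g (here refl)) (sum-mono f g xs (λ x∈ → f≤g (there x∈)))

  sum-bounded : ∀ {A : Set} (f : A → ℕ) k xs → (∀ {x} → x ∈ xs → f x ≤ k) →
                sum (map f xs) ≤ length xs * k
  sum-bounded f k []       _   = z≤n
  sum-bounded f k (x ∷ xs) f≤k = +-mono-≤ (f≤k (here refl)) (sum-bounded f k xs (λ x∈ → f≤k (there x∈)))

  module _ {A B : Set} {R : A → B → Set} (R? : ∀ a b → Dec (R a b)) where

    column : List A → B → ℕ
    column as b = length (filter (λ a → R? a b) as)

    row : List B → A → ℕ
    row bs a = length (filter (R? a) bs)

    columns-cons : ∀ a as bs →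
      sum (map (column (a ∷ as)) bs) ≡ row bs a + sum (map (column as) bs)
    columns-cons a as []       = refl
    columns-cons a as (b ∷ bs) with R? a b
    ... | yes _ = cong suc (trans (cong (column as b +_) (columns-cons a as bs))
                                  (x∙yz≈y∙xz (column as b) (row bs a) _))
    ... | no _  = trans (cong (column as b +_) (columns-cons a as bs))
                        (x∙yz≈y∙xz (column as b) (row bs a) _)

    double-count : ∀ as bs → sum (map (column as) bs) ≡ sum (map (row bs) as)
    double-count []       []       = refl
    double-count []       (b ∷ bs) = double-count [] bs
    double-count (a ∷ as) bs       =
      trans (columns-cons a as bs) (cong (row bs a +_) (double-count as bs))

-- sparseCount ws k = Σ over sets J of at most k positions of ∏_{j ∈ J} w_j.
sparseCount : List ℕ → ℕ → ℕ
sparseCount []       k       = 1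
sparseCount (w ∷ ws) zero    = sparseCount ws zero
sparseCount (w ∷ ws) (suc k) = sparseCount ws (suc k) + w * sparseCount ws k

module SparseChoices {A : Set} where
  open Suffixes {A}

  -- sparseChoices xss k: the tuples (t₁, …, t_r), r = length xss, where each t_j is
  -- a suffix of the j-th list of xss and at most k of the t_j are nonempty.
  sparseChoices : List (List A) → ℕ → List (List (List A))
  sparseChoices []         k       = [] ∷ []
  sparseChoices (xs ∷ xss) zero    = map ([] ∷_) (sparseChoices xss zero)
  sparseChoices (xs ∷ xss) (suc k) =
    map ([] ∷_) (sparseChoices xss (suc k)) ++
    concatMap (λ t → map (t ∷_) (sparseChoices xss k)) (nonemptySuffixes xs)

  length-sparseChoices : ∀ xss k → length (sparseChoices xss k) ≡ sparseCount (map length xss) k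
  length-sparseChoices []         k       = refl
  length-sparseChoices (xs ∷ xss) zero    =
    trans (List.length-map _ (sparseChoices xss zero)) (length-sparseChoices xss zero)
  length-sparseChoices (xs ∷ xss) (suc k) = begin
      length (map ([] ∷_) rest ++ concatMap extend (nonemptySuffixes xs))
    ≡⟨ List.length-++ (map ([] ∷_) rest) ⟩
      length (map ([] ∷_) rest) + length (concatMap extend (nonemptySuffixes xs))
    ≡⟨ cong₂ _+_ (List.length-map _ rest) (length-concatMap (nonemptySuffixes xs)) ⟩
      length rest + length (nonemptySuffixes xs) * length (sparseChoices xss k)
    ≡⟨ cong₂ (λ a b → a + b * length (sparseChoices xss k))
             (length-sparseChoices xss (suc k)) (length-nonemptySuffixes xs) ⟩
      sparseCount (map length xss) (suc k) + length xs * length (sparseChoices xss k)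
    ≡⟨ cong (λ c → sparseCount (map length xss) (suc k) + length xs * c) (length-sparseChoices xss k) ⟩
      sparseCount (map length (xs ∷ xss)) (suc k)
    ∎
    where
    open ≡-Reasoning
    rest = sparseChoices xss (suc k)
    extend : List A → List (List (List A))
    extend t = map (t ∷_) (sparseChoices xss k)
    length-concatMap : ∀ ts → length (concatMap extend ts) ≡ length ts * length (sparseChoices xss k)
    length-concatMap []       = refl
    length-concatMap (t ∷ ts) = trans (List.length-++ (extend t))
      (cong₂ _+_ (List.length-map _ (sparseChoices xss k)) (length-concatMap ts))

  NonEmpty : List A → Set
  NonEmpty xs = xs ≢ []

  nonEmpty? : Decidable NonEmpty
  nonEmpty? []      = no (λ []≢[] → []≢[] refl)
  nonEmpty? (_ ∷ _) = yes (λ ())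

  sparseChoices-complete : ∀ {ts xss} k → Pointwise Suffix ts xss →
    length (filter nonEmpty? ts) ≤ k → ts ∈ sparseChoices xss k
  sparseChoices-complete k [] _ = here refl
  sparseChoices-complete {[] ∷ ts} {xs ∷ xss} zero (_ ∷ sufs) few =
    ∈-map⁺ ([] ∷_) (sparseChoices-complete zero sufs few)
  sparseChoices-complete {[] ∷ ts} {xs ∷ xss} (suc k) (_ ∷ sufs) few =
    ∈-++⁺ˡ (∈-map⁺ ([] ∷_) (sparseChoices-complete (suc k) sufs few))
  sparseChoices-complete {(y ∷ ys) ∷ ts} {xs ∷ xss} (suc k) (suf ∷ sufs) (s≤s few) =
    ∈-++⁺ʳ (map ([] ∷_) (sparseChoices xss (suc k)))
      (∈-concat⁺′ (∈-map⁺ ((y ∷ ys) ∷_) (sparseChoices-complete k sufs few))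
                  (∈-map⁺ (λ t → map (t ∷_) (sparseChoices xss k)) (suffix-nonempty suf)))

data ParityView : ℕ → Set where
  even : ∀ m → ParityView (m + m)
  odd  : ∀ m → ParityView (suc (m + m))

parityView : ∀ n → ParityView n
parityView zero = even zero
parityView (suc n) with parityView n
... | even m = odd m
... | odd m  = subst ParityView (cong suc (+-suc m m)) (even (suc m))

module PowerFactorial where

  ^-distribʳ-* : ∀ a b k → (a * b) ^ k ≡ a ^ k * b ^ k
  ^-distribʳ-* a b zero    = refl
  ^-distribʳ-* a b (suc k) = trans (cong ((a * b) *_) (^-distribʳ-* a b k)) (swap-middle a b (a ^ k) (b ^ k))
    where
    swap-middle : ∀ a b x y → (a * b) * (x * y) ≡ (a * x) * (b * y)
    swap-middle = solve-∀

  bernoulli : ∀ a s j → a ^ suc j + suc j * s * a ^ j ≤ (a + s) ^ suc j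
  bernoulli a s zero = ≤-reflexive (base a s)
    where
    base : ∀ a s → a * 1 + (s + 0 * s) * 1 ≡ (a + s) * 1
    base = solve-∀
  bernoulli a s (suc j) = begin
      a * (a * P) + (2 + j) * s * (a * P)
    ≤⟨ m≤m+n _ ((1 + j) * s * s * P) ⟩
      a * (a * P) + (2 + j) * s * (a * P) + (1 + j) * s * s * P
    ≡⟨ expand a s j P ⟩
      (a + s) * (a * P + (1 + j) * s * P)
    ≤⟨ *-monoʳ-≤ (a + s) (bernoulli a s j) ⟩
      (a + s) * (a + s) ^ suc j
    ∎
    where
    open ≤-Reasoning
    P = a ^ j
    expand : ∀ a s j P → a * (a * P) + (2 + j) * s * (a * P) + (1 + j) * s * s * P ≡
                         (a + s) * (a * P + (1 + j) * s * P)
    expand = solve-∀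

  mean-value : ∀ a h → (a + 1) ^ suc h ≤ a ^ h * (a + 1) + h * (a + 1) ^ h
  mean-value a zero = ≤-reflexive (base a)
    where
    base : ∀ a → (a + 1) * 1 ≡ 1 * (a + 1) + 0 * 1
    base = solve-∀
  mean-value a (suc h) = begin
      (a + 1) * ((a + 1) * Q)
    ≤⟨ *-monoʳ-≤ (a + 1) (mean-value a h) ⟩
      (a + 1) * (P * (a + 1) + h * Q)
    ≡⟨ expand a P Q h ⟩
      (a * P) * (a + 1) + P * (a + 1) + h * ((a + 1) * Q)
    ≤⟨ +-monoˡ-≤ (h * ((a + 1) * Q)) (+-monoʳ-≤ ((a * P) * (a + 1)) P[a+1]≤[a+1]Q) ⟩
      (a * P) * (a + 1) + (a + 1) * Q + h * ((a + 1) * Q)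
    ≡⟨ collect a P Q h ⟩
      (a * P) * (a + 1) + (1 + h) * ((a + 1) * Q)
    ∎
    where
    open ≤-Reasoning
    P = a ^ h
    Q = (a + 1) ^ h
    P[a+1]≤[a+1]Q : P * (a + 1) ≤ (a + 1) * Q
    P[a+1]≤[a+1]Q = ≤-trans (≤-reflexive (*-comm P (a + 1))) (*-monoʳ-≤ (a + 1) (^-monoˡ-≤ h (m≤m+n a 1)))
    expand : ∀ a P Q h → (a + 1) * (P * (a + 1) + h * Q) ≡ (a * P) * (a + 1) + P * (a + 1) + h * ((a + 1) * Q)
    expand = solve-∀
    collect : ∀ a P Q h → (a * P) * (a + 1) + (a + 1) * Q + h * ((a + 1) * Q) ≡
                          (a * P) * (a + 1) + (1 + h) * ((a + 1) * Q)
    collect = solve-∀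

  short-power : ∀ a h → h + h ≤ a + 1 → (a + 1) ^ h ≤ 2 * a ^ h
  short-power a h 2h≤a+1 = *-cancelˡ-≤ (a + 1) {{nonZero}} (begin
      (a + 1) * Q
    ≤⟨ +-cancelʳ-≤ ((a + 1) * Q) _ _ (begin
        (a + 1) * Q + (a + 1) * Q
      ≡⟨ double a Q ⟩
        2 * ((a + 1) * Q)
      ≤⟨ *-monoʳ-≤ 2 (mean-value a h) ⟩
        2 * (P * (a + 1) + h * Q)
      ≡⟨ distribute a P Q h ⟩
        2 * (P * (a + 1)) + (h + h) * Q
      ≤⟨ +-monoʳ-≤ (2 * (P * (a + 1))) (*-monoˡ-≤ Q 2h≤a+1) ⟩
        2 * (P * (a + 1)) + (a + 1) * Q
      ∎) ⟩
      2 * (P * (a + 1))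
    ≡⟨ commute a P ⟩
      (a + 1) * (2 * P)
    ∎)
    where
    open ≤-Reasoning
    P = a ^ h
    Q = (a + 1) ^ h
    nonZero : NonZero (a + 1)
    nonZero = ≢-nonZero (λ a+1≡0 → 1+n≢0 (trans (+-comm 1 a) a+1≡0))
    double : ∀ a Q → (a + 1) * Q + (a + 1) * Q ≡ 2 * ((a + 1) * Q)
    double = solve-∀
    distribute : ∀ a P Q h → 2 * (P * (a + 1) + h * Q) ≡ 2 * (P * (a + 1)) + (h + h) * Q
    distribute = solve-∀
    commute : ∀ a P → 2 * (P * (a + 1)) ≡ (a + 1) * (2 * P)
    commute = solve-∀

  -- (1 + 1/a)^a ≤ 8: split the exponent into two halves and apply short-power to each.
  one-more-power : ∀ a → (a + 1) ^ a ≤ 8 * a ^ a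
  one-more-power a = go (parityView a)
    where
    open ≤-Reasoning
    go : ∀ {a} → ParityView a → (a + 1) ^ a ≤ 8 * a ^ a
    go {a} (even h) = begin
        (a + 1) ^ (h + h)
      ≡⟨ ^-distribˡ-+-* (a + 1) h h ⟩
        (a + 1) ^ h * (a + 1) ^ h
      ≤⟨ *-mono-≤ half half ⟩
        (2 * a ^ h) * (2 * a ^ h)
      ≡⟨ square (a ^ h) ⟩
        4 * (a ^ h * a ^ h)
      ≡⟨ cong (4 *_) (^-distribˡ-+-* a h h) ⟨
        4 * a ^ (h + h)
      ≤⟨ *-monoˡ-≤ (a ^ (h + h)) (m≤m+n 4 4) ⟩
        8 * a ^ (h + h)
      ∎
      where
      half : (a + 1) ^ h ≤ 2 * a ^ h
      half = short-power a h (m≤m+n a 1)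
      square : ∀ x → (2 * x) * (2 * x) ≡ 4 * (x * x)
      square = solve-∀
    go {a} (odd h) = begin
        (a + 1) * (a + 1) ^ (h + h)
      ≡⟨ cong ((a + 1) *_) (^-distribˡ-+-* (a + 1) h h) ⟩
        (a + 1) * ((a + 1) ^ h * (a + 1) ^ h)
      ≤⟨ *-mono-≤ a+1≤2a (*-mono-≤ half half) ⟩
        (2 * a) * ((2 * a ^ h) * (2 * a ^ h))
      ≡⟨ cube a (a ^ h) ⟩
        8 * (a * (a ^ h * a ^ h))
      ≡⟨ cong (λ z → 8 * (a * z)) (^-distribˡ-+-* a h h) ⟨
        8 * (a * a ^ (h + h))
      ∎
      where
      a+1≤2a : a + 1 ≤ 2 * a
      a+1≤2a = +-monoʳ-≤ a (≤-trans (s≤s z≤n) (m≤m+n a 0))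
      half : (a + 1) ^ h ≤ 2 * a ^ h
      half = short-power a h (≤-trans (m≤n+m (h + h) 1) (m≤m+n a 1))
      cube : ∀ a x → (2 * a) * ((2 * x) * (2 * x)) ≡ 8 * (a * (x * x))
      cube = solve-∀

  power≤8^k*factorial : ∀ k → k ^ k ≤ 8 ^ k * k !
  power≤8^k*factorial zero    = ≤-refl
  power≤8^k*factorial (suc k) = begin
      suc k * suc k ^ k
    ≤⟨ *-monoʳ-≤ (suc k) (≤-trans (≤-reflexive (cong (_^ k) (+-comm 1 k))) (one-more-power k)) ⟩
      suc k * (8 * k ^ k)
    ≤⟨ *-monoʳ-≤ (suc k) (*-monoʳ-≤ 8 (power≤8^k*factorial k)) ⟩
      suc k * (8 * (8 ^ k * k !))
    ≡⟨ regroup (suc k) (8 ^ k) (k !) ⟩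
      (8 * 8 ^ k) * (suc k * k !)
    ∎
    where
    open ≤-Reasoning
    regroup : ∀ a x f → a * (8 * (x * f)) ≡ (8 * x) * (a * f)
    regroup = solve-∀

  factorial≤power : ∀ k → k ! ≤ k ^ k
  factorial≤power zero    = ≤-refl
  factorial≤power (suc k) = *-monoʳ-≤ (suc k) (≤-trans (factorial≤power k) (^-monoˡ-≤ k (n≤1+n k)))

  -- k!·sparseCount ws k ≤ (Σ ws + k)^k: choosing ≤ k weighted positions in order
  -- is at most choosing k times among Σ ws + k options.
  sparseCount-bound : ∀ ws k → k ! * sparseCount ws k ≤ (sum ws + k) ^ k
  sparseCount-bound []       k       = ≤-trans (≤-reflexive (*-identityʳ (k !))) (factorial≤power k)
  sparseCount-bound (w ∷ ws) zero    = sparseCount-bound ws zero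
  sparseCount-bound (w ∷ ws) (suc k) = begin
      (suc k * k !) * (sparseCount ws (suc k) + w * sparseCount ws k)
    ≡⟨ distribute (suc k) (k !) (sparseCount ws (suc k)) w (sparseCount ws k) ⟩
      (suc k * k !) * sparseCount ws (suc k) + suc k * w * (k ! * sparseCount ws k)
    ≤⟨ +-mono-≤ (sparseCount-bound ws (suc k)) (*-monoʳ-≤ (suc k * w) (sparseCount-bound ws k)) ⟩
      (W + suc k) ^ suc k + suc k * w * (W + k) ^ k
    ≤⟨ +-monoʳ-≤ ((W + suc k) ^ suc k) (*-monoʳ-≤ (suc k * w) (^-monoˡ-≤ k (+-monoʳ-≤ W (n≤1+n k)))) ⟩
      (W + suc k) ^ suc k + suc k * w * (W + suc k) ^ k
    ≤⟨ bernoulli (W + suc k) w k ⟩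
      (W + suc k + w) ^ suc k
    ≡⟨ cong (_^ suc k) (reorder W (suc k) w) ⟩
      (w + W + suc k) ^ suc k
    ∎
    where
    open ≤-Reasoning
    W = sum ws
    distribute : ∀ a f x w y → (a * f) * (x + w * y) ≡ (a * f) * x + a * w * (f * y)
    distribute = solve-∀
    reorder : ∀ W a w → W + a + w ≡ w + W + a
    reorder = solve-∀

module CentralBinomial where
  open import Data.Nat.Combinatorics using (_C_; nCk+nC[k+1]≡[n+1]C[k+1]; nCk≡nC[n∸k]; nC1≡n)

  pascal : ∀ n k → suc n C suc k ≡ n C k + n C suc k
  pascal n k = sym (nCk+nC[k+1]≡[n+1]C[k+1] n k)

  absorption : ∀ n k → suc k * (suc n C suc k) ≡ suc n * (n C k)
  absorption zero    zero    = refl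
  absorption zero    (suc k) = *-zeroʳ (suc (suc k))
  absorption (suc n) zero    =
    trans (*-identityˡ _) (trans (nC1≡n (suc (suc n))) (sym (*-identityʳ (suc (suc n)))))
  absorption (suc n) (suc k) = begin
      suc (suc k) * (suc (suc n) C suc (suc k))
    ≡⟨ cong (suc (suc k) *_) (pascal (suc n) (suc k)) ⟩
      suc (suc k) * (suc n C suc k + suc n C suc (suc k))
    ≡⟨ split (suc k) (suc n C suc k) (suc n C suc (suc k)) ⟩
      suc k * (suc n C suc k) + suc n C suc k + suc (suc k) * (suc n C suc (suc k))
    ≡⟨ cong₂ (λ x y → x + suc n C suc k + y) (absorption n k) (absorption n (suc k)) ⟩
      suc n * (n C k) + suc n C suc k + suc n * (n C suc k)
    ≡⟨ cong (λ x → suc n * (n C k) + x + suc n * (n C suc k)) (pascal n k) ⟩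
      suc n * (n C k) + (n C k + n C suc k) + suc n * (n C suc k)
    ≡⟨ merge (suc n) (n C k) (n C suc k) ⟩
      suc (suc n) * (n C k + n C suc k)
    ≡⟨ cong (suc (suc n) *_) (pascal n k) ⟨
      suc (suc n) * (suc n C suc k)
    ∎
    where
    open ≡-Reasoning
    split : ∀ k x y → (1 + k) * (x + y) ≡ k * x + x + (1 + k) * y
    split = solve-∀
    merge : ∀ n x y → n * x + (x + y) + n * y ≡ (1 + n) * (x + y)
    merge = solve-∀

  middle-symmetry : ∀ m → suc (m + m) C suc m ≡ suc (m + m) C m
  middle-symmetry m =
    trans (nCk≡nC[n∸k] (s≤s (m≤n+m m m))) (cong (suc (m + m) C_) (m+n∸n≡m m m))

  central-even-step : ∀ m → suc (suc (m + m)) * (suc (m + m) C m) ≡ 2 * (suc (m + m) * ((m + m) C m))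
  central-even-step m = begin
      suc (suc (m + m)) * (suc (m + m) C m)
    ≡⟨ twice m (suc (m + m) C m) ⟩
      2 * (suc m * (suc (m + m) C m))
    ≡⟨ cong (λ x → 2 * (suc m * x)) (middle-symmetry m) ⟨
      2 * (suc m * (suc (m + m) C suc m))
    ≡⟨ cong (2 *_) (absorption (m + m) m) ⟩
      2 * (suc (m + m) * ((m + m) C m))
    ∎
    where
    open ≡-Reasoning
    twice : ∀ m x → (2 + (m + m)) * x ≡ 2 * ((1 + m) * x)
    twice = solve-∀

  central-odd-step : ∀ m → suc (suc (m + m)) C suc m ≡ 2 * (suc (m + m) C m)
  central-odd-step m = begin
      suc (suc (m + m)) C suc m
    ≡⟨ pascal (suc (m + m)) m ⟩
      suc (m + m) C m + suc (m + m) C suc m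
    ≡⟨ cong (suc (m + m) C m +_) (middle-symmetry m) ⟩
      suc (m + m) C m + suc (m + m) C m
    ≡⟨ cong (suc (m + m) C m +_) (+-identityʳ _) ⟨
      2 * (suc (m + m) C m)
    ∎
    where open ≡-Reasoning

  central-step : ∀ n → 2 * (suc n * (n C ⌊ n /2⌋)) ≤ suc (suc n) * (suc n C ⌊ suc n /2⌋)
  central-step n = go (parityView n)
    where
    -- The rewrites evaluate the halves ⌊2m/2⌋ and ⌈2m/2⌉ to m.
    go : ∀ {n} → ParityView n → 2 * (suc n * (n C ⌊ n /2⌋)) ≤ suc (suc n) * (suc n C ⌊ suc n /2⌋)
    go (even m) rewrite sym (n≡⌊n+n/2⌋ m) | sym (n≡⌈n+n/2⌉ m) =
      ≤-reflexive (sym (central-even-step m))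
    go (odd m) rewrite sym (n≡⌈n+n/2⌉ m) | sym (n≡⌊n+n/2⌋ m) = begin
        2 * (suc (suc (m + m)) * X)
      ≤⟨ *-monoʳ-≤ 2 (*-monoˡ-≤ X (n≤1+n (suc (suc (m + m))))) ⟩
        2 * (suc (suc (suc (m + m))) * X)
      ≡⟨ swap (suc (suc (suc (m + m)))) X ⟩
        suc (suc (suc (m + m))) * (2 * X)
      ≡⟨ cong (suc (suc (suc (m + m))) *_) (central-odd-step m) ⟨
        suc (suc (suc (m + m))) * (suc (suc (m + m)) C suc m)
      ∎
      where
      open ≤-Reasoning
      X = suc (m + m) C m
      swap : ∀ a x → 2 * (a * x) ≡ a * (2 * x)
      swap = solve-∀

  central-binomial : ∀ n → 2 ^ n ≤ suc n * (n C ⌊ n /2⌋)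
  central-binomial zero    = ≤-refl
  central-binomial (suc n) = ≤-trans (*-monoʳ-≤ 2 (central-binomial n)) (central-step n)

module Logarithms where
  open import Data.Nat.Logarithm using (⌊log₂⌋-mono-≤; ⌊log₂[2^n]⌋≡n; ⌊log₂⌊n/2⌋⌋≡⌊log₂n⌋∸1)
  open import Data.Nat.Induction using (<-rec)

  2^-reflects-≤ : ∀ a b → 2 ^ a ≤ 2 ^ b → a ≤ b
  2^-reflects-≤ a b 2^a≤2^b with a ≤? b
  ... | yes a≤b = a≤b
  ... | no a≰b  = contradiction (^-monoʳ-< 2 (s≤s (s≤s z≤n)) (≰⇒> a≰b)) (≤⇒≯ 2^a≤2^b)

  log-upper : ∀ n → n < 2 ^ suc ⌊log₂ n ⌋
  log-upper n with 2 ^ suc ⌊log₂ n ⌋ ≤? n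
  ... | no  n≱ = ≰⇒> n≱
  ... | yes 2^≤n = contradiction (subst (_≤ ⌊log₂ n ⌋) (⌊log₂[2^n]⌋≡n (suc ⌊log₂ n ⌋)) (⌊log₂⌋-mono-≤ 2^≤n))
                                 (n≮n ⌊log₂ n ⌋)

  log-lower : ∀ n → 1 ≤ n → 2 ^ ⌊log₂ n ⌋ ≤ n
  log-lower = <-rec (λ n → 1 ≤ n → 2 ^ ⌊log₂ n ⌋ ≤ n) go
    where
    go : ∀ n → (∀ {m} → m < n → 1 ≤ m → 2 ^ ⌊log₂ m ⌋ ≤ m) → 1 ≤ n → 2 ^ ⌊log₂ n ⌋ ≤ n
    go (suc zero)    _   _ = ≤-refl
    go (suc (suc n)) rec _ = begin
        2 ^ ℓ
      ≡⟨ cong (2 ^_) (m+[n∸m]≡n 1≤ℓ) ⟨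
        2 * 2 ^ (ℓ ∸ 1)
      ≡⟨ cong (λ e → 2 * 2 ^ e) (⌊log₂⌊n/2⌋⌋≡⌊log₂n⌋∸1 (suc (suc n))) ⟨
        2 * 2 ^ ⌊log₂ ⌊ suc (suc n) /2⌋ ⌋
      ≤⟨ *-monoʳ-≤ 2 (rec (⌊n/2⌋<n (suc n)) (s≤s z≤n)) ⟩
        2 * ⌊ suc (suc n) /2⌋
      ≡⟨ cong (⌊ suc (suc n) /2⌋ +_) (+-identityʳ ⌊ suc (suc n) /2⌋) ⟩
        ⌊ suc (suc n) /2⌋ + ⌊ suc (suc n) /2⌋
      ≤⟨ +-monoʳ-≤ ⌊ suc (suc n) /2⌋ (⌊n/2⌋≤⌈n/2⌉ (suc (suc n))) ⟩
        ⌊ suc (suc n) /2⌋ + ⌈ suc (suc n) /2⌉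
      ≡⟨ ⌊n/2⌋+⌈n/2⌉≡n (suc (suc n)) ⟩
        suc (suc n)
      ∎
      where
      open ≤-Reasoning
      ℓ = ⌊log₂ suc (suc n) ⌋
      1≤ℓ : 1 ≤ ℓ
      1≤ℓ = ⌊log₂⌋-mono-≤ {2} {suc (suc n)} (s≤s (s≤s z≤n))

  linear≤2^ : ∀ l → suc l ≤ 2 ^ l
  linear≤2^ zero    = ≤-refl
  linear≤2^ (suc l) = +-mono-≤ (m^n>0 2 l) (≤-trans (linear≤2^ l) (m≤m+n (2 ^ l) 0))

  quadratic≤2^ : ∀ l → l * suc l ≤ 2 ^ suc l
  quadratic≤2^ zero    = z≤n
  quadratic≤2^ (suc l) = begin
      suc l * suc (suc l)
    ≡⟨ expand l ⟩
      l * suc l + 2 * suc l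
    ≤⟨ +-mono-≤ (quadratic≤2^ l) (*-monoʳ-≤ 2 (linear≤2^ l)) ⟩
      2 ^ suc l + 2 * 2 ^ l
    ≡⟨ collect (2 ^ l) ⟩
      2 * (2 * 2 ^ l)
    ∎
    where
    open ≤-Reasoning
    expand : ∀ l → (1 + l) * (2 + l) ≡ l * (1 + l) + 2 * (1 + l)
    expand = solve-∀
    collect : ∀ x → 2 * x + 2 * x ≡ 2 * (2 * x)
    collect = solve-∀

module Estimates where
  open import Data.Nat.Combinatorics using (_C_)
  open import Data.Nat.Logarithm using (⌊log₂⌋-mono-≤)
  open PowerFactorial
  open CentralBinomial using (central-binomial)
  open Logarithms

  -- Since k^k ≤ 8^k·k!, the sparse count is at most (8(n+1))^k.
  sparse-binomial-bound : ∀ n k ws → n C ⌊ n /2⌋ ≤ sparseCount ws k → sum ws ≤ k * n →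
                          n C ⌊ n /2⌋ ≤ 8 ^ k * suc n ^ k
  sparse-binomial-bound n k ws C≤count Σws≤kn = *-cancelˡ-≤ (k !) {{k !≢0}} (begin
      k ! * (n C ⌊ n /2⌋)
    ≤⟨ *-monoʳ-≤ (k !) C≤count ⟩
      k ! * sparseCount ws k
    ≤⟨ sparseCount-bound ws k ⟩
      (sum ws + k) ^ k
    ≤⟨ ^-monoˡ-≤ k (+-monoˡ-≤ k Σws≤kn) ⟩
      (k * n + k) ^ k
    ≡⟨ cong (_^ k) (factor k n) ⟩
      (k * suc n) ^ k
    ≡⟨ ^-distribʳ-* k (suc n) k ⟩
      k ^ k * suc n ^ k
    ≤⟨ *-monoˡ-≤ (suc n ^ k) (power≤8^k*factorial k) ⟩
      (8 ^ k * k !) * suc n ^ k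
    ≡⟨ regroup (8 ^ k) (k !) (suc n ^ k) ⟩
      k ! * (8 ^ k * suc n ^ k)
    ∎)
    where
    open ≤-Reasoning
    factor : ∀ k n → k * n + k ≡ k * (1 + n)
    factor = solve-∀
    regroup : ∀ a f b → (a * f) * b ≡ f * (a * b)
    regroup = solve-∀

  -- Combined with 2^n ≤ (n+1)·C(n, ⌊n/2⌋) and n+1 ≤ 2^(ℓ+1), comparing exponents
  -- gives n ≤ ℓ + 1 + (ℓ + 4)·k, where ℓ = ⌊log₂ n⌋.
  exponent-bound : ∀ n k → n C ⌊ n /2⌋ ≤ 8 ^ k * suc n ^ k → n ≤ suc ⌊log₂ n ⌋ + (4 + ⌊log₂ n ⌋) * k
  exponent-bound n k C≤ = 2^-reflects-≤ _ _ (begin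
      2 ^ n
    ≤⟨ central-binomial n ⟩
      suc n * (n C ⌊ n /2⌋)
    ≤⟨ *-monoʳ-≤ (suc n) C≤ ⟩
      suc n * (8 ^ k * suc n ^ k)
    ≤⟨ *-mono-≤ n<X (*-monoʳ-≤ (8 ^ k) (^-monoˡ-≤ k n<X)) ⟩
      X * (8 ^ k * X ^ k)
    ≡⟨ cong (X *_) (^-distribʳ-* 8 X k) ⟨
      X * (8 * X) ^ k
    ≡⟨ cong (λ y → X * y ^ k) (eight-times X) ⟩
      X * (2 ^ (4 + ℓ)) ^ k
    ≡⟨ cong (X *_) (^-*-assoc 2 (4 + ℓ) k) ⟩
      X * 2 ^ ((4 + ℓ) * k)
    ≡⟨ ^-distribˡ-+-* 2 (suc ℓ) ((4 + ℓ) * k) ⟨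
      2 ^ (suc ℓ + (4 + ℓ) * k)
    ∎)
    where
    open ≤-Reasoning
    ℓ = ⌊log₂ n ⌋
    X = 2 ^ suc ℓ
    n<X : suc n ≤ X
    n<X = log-upper n
    eight-times : ∀ x → 8 * x ≡ 2 * (2 * (2 * x))
    eight-times = solve-∀

  -- Rearranging n ≤ ℓ + 1 + (ℓ + 4)·k into k ≥ n/ℓ − 6·n·⌊log₂ ℓ⌋/ℓ², cleared of denominators.
  rearranged-bound : ∀ n k → 4 ≤ n → n ≤ suc ⌊log₂ n ⌋ + (4 + ⌊log₂ n ⌋) * k →
    n * ⌊log₂ n ⌋ ≤ k * (⌊log₂ n ⌋ * ⌊log₂ n ⌋) + 6 * n * ⌊log₂ ⌊log₂ n ⌋ ⌋
  rearranged-bound n k 4≤n n≤ with n ≤? k * ⌊log₂ n ⌋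
  ... | yes n≤kℓ = ≤-trans (*-monoˡ-≤ ℓ n≤kℓ) (≤-trans (≤-reflexive (*-assoc k ℓ ℓ)) (m≤m+n _ _))
    where ℓ = ⌊log₂ n ⌋
  ... | no n≰kℓ = begin
      n * ℓ
    ≤⟨ *-monoˡ-≤ ℓ n≤ ⟩
      (suc ℓ + (4 + ℓ) * k) * ℓ
    ≡⟨ expand ℓ k ⟩
      k * (ℓ * ℓ) + (ℓ * suc ℓ + 4 * (k * ℓ))
    ≤⟨ +-monoʳ-≤ (k * (ℓ * ℓ)) (+-mono-≤ ℓ[ℓ+1]≤2n (*-monoʳ-≤ 4 kℓ≤n)) ⟩
      k * (ℓ * ℓ) + (2 * n + 4 * n)
    ≡⟨ cong (k * (ℓ * ℓ) +_) (six n) ⟩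
      k * (ℓ * ℓ) + 6 * n * 1
    ≤⟨ +-monoʳ-≤ (k * (ℓ * ℓ)) (*-monoʳ-≤ (6 * n) 1≤logℓ) ⟩
      k * (ℓ * ℓ) + 6 * n * ⌊log₂ ℓ ⌋
    ∎
    where
    open ≤-Reasoning
    ℓ = ⌊log₂ n ⌋
    kℓ≤n : k * ℓ ≤ n
    kℓ≤n = <⇒≤ (≰⇒> n≰kℓ)
    2≤ℓ : 2 ≤ ℓ
    2≤ℓ = ⌊log₂⌋-mono-≤ {4} {n} 4≤n
    1≤logℓ : 1 ≤ ⌊log₂ ℓ ⌋
    1≤logℓ = ⌊log₂⌋-mono-≤ {2} {ℓ} 2≤ℓ
    ℓ[ℓ+1]≤2n : ℓ * suc ℓ ≤ 2 * n
    ℓ[ℓ+1]≤2n = ≤-trans (quadratic≤2^ ℓ) (*-monoʳ-≤ 2 (log-lower n (≤-trans (s≤s z≤n) 4≤n)))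
    expand : ∀ l k → (1 + l + (4 + l) * k) * l ≡ k * (l * l) + (l * (1 + l) + 4 * (k * l))
    expand = solve-∀
    six : ∀ n → 2 * n + 4 * n ≡ 6 * n * 1
    six = solve-∀

-- Local dimension is monotone under passing to an induced subposet: restricting every
-- partial linear extension of a local realiser to the smaller ground set Y gives a
-- local realiser of Y, and multiplicities can only drop.
module Restriction {A : Set} (_≟_ : DecidableEquality A) (_≼_ : A → A → Set)
                   {X Y : A → Set} (Y? : Decidable Y) (Y⇒X : ∀ {x} → Y x → X x) where
  open ListFacts {A}
  private
    module PX = LocalDim _≟_ X _≼_
    module PY = LocalDim _≟_ Y _≼_
  open PX.PartialLinExt
  open PX.LocalRealiser

  restrict-ple : ∀ {L} → PX.PartialLinExt L → PY.PartialLinExt (filter Y? L)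
  restrict-ple {L} ple = record
    { inX      = All.all-filter Y? L
    ; unique   = Unique.filter⁺ Y? (unique ple)
    ; respects = λ x y x∈ y∈ x≼y →
        let x∈L , Yx = ∈-filter⁻ Y? x∈
            y∈L , Yy = ∈-filter⁻ Y? y∈
        in ≤-filter Y? Yx Yy (respects ple x y x∈L y∈L x≼y)
    }

  restrict-realiser : ∀ {ℒ} → PX.LocalRealiser ℒ → PY.LocalRealiser (map (filter Y?) ℒ)
  restrict-realiser R = record
    { ples   = All.map⁺ (All.map restrict-ple (ples R))
    ; covers = λ x y Yx Yy y⋠x →
        let L , L∈ , x∈ , y∈ , x≤y = covers R x y (Y⇒X Yx) (Y⇒X Yy) y⋠x
        in filter Y? L , ∈-map⁺ (filter Y?) L∈ , ∈-filter⁺ Y? x∈ Yx , ∈-filter⁺ Y? y∈ Yy ,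
           ≤-filter Y? Yx Yy x≤y
    }

  restrict-ldim : ∀ {k} → PX.LdimAtMost k → PY.LdimAtMost k
  restrict-ldim (ℒ , R , μ≤k) =
    map (filter Y?) ℒ , restrict-realiser R ,
    λ x Yx → ≤-trans (count-map-≤ _ _ (filter Y?) (λ L x∈ → proj₁ (∈-filter⁻ Y? x∈)) ℒ)
                     (μ≤k x (Y⇒X Yx))

module SubsetsOfSize where
  open import Data.Nat.Combinatorics using (_C_; nCk+nC[k+1]≡[n+1]C[k+1])
  open import Data.Vec using (_∷_)
  import Data.Fin.Subset as Subset
  open import Data.Fin.Subset.Properties using (∣⊥∣≡0)

  subsetsOfSize : (n m : ℕ) → List (Subset n)
  subsetsOfSize n       zero    = Subset.⊥ ∷ []
  subsetsOfSize zero    (suc m) = []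
  subsetsOfSize (suc n) (suc m) =
    map (true ∷_) (subsetsOfSize n m) ++ map (false ∷_) (subsetsOfSize n (suc m))

  length-subsetsOfSize : ∀ n m → length (subsetsOfSize n m) ≡ n C m
  length-subsetsOfSize n       zero    = refl
  length-subsetsOfSize zero    (suc m) = refl
  length-subsetsOfSize (suc n) (suc m) = begin
      length (map (true ∷_) (subsetsOfSize n m) ++ map (false ∷_) (subsetsOfSize n (suc m)))
    ≡⟨ List.length-++ (map (true ∷_) (subsetsOfSize n m)) ⟩
      length (map (true ∷_) (subsetsOfSize n m)) + length (map (false ∷_) (subsetsOfSize n (suc m)))
    ≡⟨ cong₂ _+_ (List.length-map _ (subsetsOfSize n m)) (List.length-map _ (subsetsOfSize n (suc m))) ⟩
      length (subsetsOfSize n m) + length (subsetsOfSize n (suc m))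
    ≡⟨ cong₂ _+_ (length-subsetsOfSize n m) (length-subsetsOfSize n (suc m)) ⟩
      n C m + n C suc m
    ≡⟨ nCk+nC[k+1]≡[n+1]C[k+1] n m ⟩
      suc n C suc m
    ∎
    where open ≡-Reasoning

  subsetsOfSize-size : ∀ n m → All (λ s → ∣ s ∣ ≡ m) (subsetsOfSize n m)
  subsetsOfSize-size n       zero    = ∣⊥∣≡0 n ∷ []
  subsetsOfSize-size zero    (suc m) = []
  subsetsOfSize-size (suc n) (suc m) =
    All.++⁺ (All.map⁺ (All.map (cong suc) (subsetsOfSize-size n m)))
            (All.map⁺ (subsetsOfSize-size n (suc m)))

  subsetsOfSize-unique : ∀ n m → Unique (subsetsOfSize n m)
  subsetsOfSize-unique n       zero    = [] ∷ []
  subsetsOfSize-unique zero    (suc m) = []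
  subsetsOfSize-unique (suc n) (suc m) =
    Unique.++⁺ (Unique.map⁺ ∷-injectiveʳ (subsetsOfSize-unique n m))
               (Unique.map⁺ ∷-injectiveʳ (subsetsOfSize-unique n (suc m))) disjoint
    where
    ∷-injectiveʳ : ∀ {b} {s t : Subset n} → b ∷ s ≡ b ∷ t → s ≡ t
    ∷-injectiveʳ refl = refl
    disjoint : ∀ {s} → ¬ (s ∈ map (true ∷_) (subsetsOfSize n m) × s ∈ map (false ∷_) (subsetsOfSize n (suc m)))
    disjoint (s∈ , s∈′) with ∈-map⁻ (true ∷_) s∈ | ∈-map⁻ (false ∷_) s∈′
    ... | _ , _ , refl | _ , _ , ()

-- Fix a local realiser ℒ of Q_n^{1,m}, m = ⌊n/2⌋ ≥ 2,
-- with multiplicities at most k. An m-set S is encoded by the tuple, over L ∈ ℒ, of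
-- the singletons following S in L: exactly the ⁅ i ⁆ with i ∉ S follow S somewhere,
-- so the code determines S, and it is a tuple of suffixes of the singleton parts of
-- the members of ℒ with at most μ(S) ≤ k nonempty entries.
module MiddleLevelEncoding {n k : ℕ} {ℒ : List (List (Subset n))}
  (realiser : LocalDim.LocalRealiser _≟S_ Levels1Half _⊆_ ℒ)
  (μ≤k : ∀ x → Levels1Half x → LocalDim.μ _≟S_ Levels1Half _⊆_ ℒ x ≤ k)
  (2≤m : 2 ≤ ⌊ n /2⌋) where

  open import Data.Nat.Combinatorics using (_C_)
  open import Data.Fin using (Fin)
  import Data.Fin.Subset as Subset
  open import Data.Fin.Subset using (⁅_⁆)
  open import Data.Fin.Subset.Properties using (x∈⁅x⁆; x∈⁅y⁆⇒x≡y; ∣⁅x⁆∣≡1; ⊆-antisym)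
  import Data.Fin.Subset.Properties as Subset
  import Data.List.Membership.DecPropositional as DecMembership
  import Data.List.Relation.Binary.Pointwise as Pointwise
  open DecMembership (_≟S_ {n}) using (_∈?_)
  private module P = LocalDim (_≟S_ {n}) Levels1Half _⊆_
  open P.LocalRealiser realiser
  open P.PartialLinExt
  open ListFacts
  open Suffixes
  open After (_≟S_ {n})
  open SparseChoices
  open SubsetsOfSize
  open Sums

  m : ℕ
  m = ⌊ n /2⌋

  singletons : List (Subset n)
  singletons = map ⁅_⁆ (allFin n)

  singleton? : Decidable (_∈ singletons)
  singleton? s = s ∈? singletons

  code : Subset n → List (List (Subset n))
  code S = map (λ L → filter singleton? (after S L)) ℒ

  ple : ∀ {L} → L ∈ ℒ → P.PartialLinExt L
  ple L∈ℒ = All.lookup ples L∈ℒ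

  singleton≢middle : ∀ {S : Subset n} i → ∣ S ∣ ≡ m → ⁅ i ⁆ ≢ S
  singleton≢middle i |S|≡m ⁅i⁆≡S =
    contradiction (subst (2 ≤_) (trans (sym |S|≡m) (trans (cong ∣_∣ (sym ⁅i⁆≡S)) (∣⁅x⁆∣≡1 i))) 2≤m)
                  (λ { (s≤s ()) })

  -- If i ∉ S then ⁅ i ⁆ ⋠ S, so some L puts ⁅ i ⁆ after S.
  outside⇒in-code : ∀ {S : Subset n} i → ∣ S ∣ ≡ m → ¬ (i Subset.∈ S) → ⁅ i ⁆ ∈ concat (code S)
  outside⇒in-code {S} i |S|≡m i∉S
    with covers S ⁅ i ⁆ (inj₂ |S|≡m) (inj₁ (∣⁅x⁆∣≡1 i)) (λ ⁅i⁆⊆S → i∉S (⁅i⁆⊆S (x∈⁅x⁆ i)))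
  ... | L , L∈ℒ , _ , _ , P , B , L≡ , here ⁅i⁆≡S = contradiction ⁅i⁆≡S (singleton≢middle i |S|≡m)
  ... | L , L∈ℒ , _ , _ , P , B , L≡ , there ⁅i⁆∈B =
    ∈-concat⁺′ (∈-filter⁺ singleton? (subst (⁅ i ⁆ ∈_) (sym after≡B) ⁅i⁆∈B) (∈-map⁺ ⁅_⁆ (∈-allFin i)))
               (∈-map⁺ (λ L → filter singleton? (after S L)) L∈ℒ)
    where
    after≡B : after S L ≡ B
    after≡B = subst (λ L → Unique L → after S L ≡ B) (sym L≡) (after-unique P) (unique (ple L∈ℒ))

  -- If i ∈ S then ⁅ i ⁆ ⊆ S, so ⁅ i ⁆ precedes S in every L containing both.
  in-code⇒outside : ∀ {S : Subset n} i → ⁅ i ⁆ ∈ concat (code S) → ¬ (i Subset.∈ S)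
  in-code⇒outside {S} i ⁅i⁆∈code i∈S with ∈-concat⁻′ (code S) ⁅i⁆∈code
  ... | ts , ⁅i⁆∈ts , ts∈code with ∈-map⁻ (λ L → filter singleton? (after S L)) ts∈code
  ... | L , L∈ℒ , refl with after-split L (proj₁ (∈-filter⁻ singleton? ⁅i⁆∈ts))
  ... | P , L≡ = later-not-before P (subst Unique L≡ (unique (ple L∈ℒ))) ⁅i⁆∈after
                   (subst (⁅ i ⁆ ≤[_] S) L≡ ⁅i⁆≤S)
    where
    ⁅i⁆∈after = proj₁ (∈-filter⁻ singleton? ⁅i⁆∈ts)
    ⁅i⁆⊆S : ⁅ i ⁆ ⊆ S
    ⁅i⁆⊆S x∈⁅i⁆ = subst (Subset._∈ S) (sym (x∈⁅y⁆⇒x≡y i x∈⁅i⁆)) i∈S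
    ⁅i⁆≤S : ⁅ i ⁆ ≤[ L ] S
    ⁅i⁆≤S = respects (ple L∈ℒ) ⁅ i ⁆ S (suffix-⊆ (after-suffix S L) ⁅i⁆∈after)
              (subst (S ∈_) (sym L≡) (∈-++⁺ʳ P (here refl))) ⁅i⁆⊆S

  code-injective : ∀ {S S′ : Subset n} → ∣ S ∣ ≡ m → ∣ S′ ∣ ≡ m → code S ≡ code S′ → S ≡ S′
  code-injective |S|≡m |S′|≡m code≡ = ⊆-antisym (included |S|≡m |S′|≡m code≡) (included |S′|≡m |S|≡m (sym code≡))
    where
    included : ∀ {S S′ : Subset n} → ∣ S ∣ ≡ m → ∣ S′ ∣ ≡ m → code S ≡ code S′ → S ⊆ S′
    included {S} {S′} |S|≡m |S′|≡m code≡ {i} i∈S with i Subset.∈? S′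
    ... | yes i∈S′ = i∈S′
    ... | no  i∉S′ = contradiction i∈S
        (in-code⇒outside i (subst (λ c → ⁅ i ⁆ ∈ concat c) (sym code≡) (outside⇒in-code i |S′|≡m i∉S′)))

  -- A nonempty code entry for L means S ∈ L, so at most μ(S) ≤ k entries are nonempty.
  code-sparse : ∀ {S : Subset n} → ∣ S ∣ ≡ m → code S ∈ sparseChoices (map (filter singleton?) ℒ) k
  code-sparse {S} |S|≡m = sparseChoices-complete k
    (Pointwise.map⁺ _ (filter singleton?) (Pointwise.refl (λ {L} → filter-suffix singleton? (after-suffix S L))))
    (≤-trans (count-map-≤ {P = NonEmpty} {Q = S ∈_} nonEmpty? (S ∈?_) (λ L → filter singleton? (after S L)) occurs ℒ)
             (μ≤k S (inj₂ |S|≡m)))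
    where
    occurs : ∀ L → NonEmpty (filter singleton? (after S L)) → S ∈ L
    occurs L nonempty with S ∈? L
    ... | yes S∈L = S∈L
    ... | no  S∉L = contradiction (cong (filter singleton?) (after-∉ L S∉L)) nonempty

  weights : List ℕ
  weights = map length (map (filter singleton?) ℒ)

  middle-binomial≤sparseCount : n C m ≤ sparseCount weights k
  middle-binomial≤sparseCount = begin
      n C m
    ≡⟨ length-subsetsOfSize n m ⟨
      length (subsetsOfSize n m)
    ≤⟨ injection-length code (subsetsOfSize-unique n m)
         (λ S∈ → code-sparse (All.lookup (subsetsOfSize-size n m) S∈))
         (λ S∈ S′∈ → code-injective (All.lookup (subsetsOfSize-size n m) S∈)
                                    (All.lookup (subsetsOfSize-size n m) S′∈)) ⟩
      length (sparseChoices (map (filter singleton?) ℒ) k)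
    ≡⟨ length-sparseChoices (map (filter singleton?) ℒ) k ⟩
      sparseCount weights k
    ∎
    where open ≤-Reasoning

  -- Double counting incidences between singletons and members of ℒ: each singleton
  -- lies in at most k members, so the weights add up to at most k·n.
  weights-sum : sum weights ≤ k * n
  weights-sum = begin
      sum weights
    ≡⟨ cong sum (List.map-∘ ℒ) ⟨
      sum (map (λ L → length (filter singleton? L)) ℒ)
    ≤⟨ sum-mono _ (column R? singletons) ℒ (λ L∈ℒ → injection-length (λ s → s)
         (Unique.filter⁺ singleton? (unique (ple L∈ℒ)))
         (λ s∈ → let s∈L , s∈singletons = ∈-filter⁻ singleton? s∈ in ∈-filter⁺ (λ s → s ∈? _) s∈singletons s∈L)
         (λ _ _ s≡t → s≡t)) ⟩
      sum (map (column R? singletons) ℒ)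
    ≡⟨ double-count R? singletons ℒ ⟩
      sum (map (row R? ℒ) singletons)
    ≤⟨ sum-bounded (row R? ℒ) k singletons singleton-multiplicity ⟩
      length singletons * k
    ≡⟨ cong (_* k) (trans (List.length-map ⁅_⁆ (allFin n)) (List.length-tabulate {n = n} (λ (i : Fin n) → i))) ⟩
      n * k
    ≡⟨ *-comm n k ⟩
      k * n
    ∎
    where
    open ≤-Reasoning
    R? : ∀ s L → Dec (s ∈ L)
    R? s L = s ∈? L
    singleton-multiplicity : ∀ {s} → s ∈ singletons → row R? ℒ s ≤ k
    singleton-multiplicity s∈ with ∈-map⁻ ⁅_⁆ s∈
    ... | i , _ , refl = μ≤k ⁅ i ⁆ (inj₁ (∣⁅x⁆∣≡1 i))

levels1Half? : ∀ {n} → Decidable (Levels1Half {n})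
levels1Half? {n} s = (∣ s ∣ ≟ 1) ⊎-dec (∣ s ∣ ≟ ⌊ n /2⌋)

corollary7 : (∀ n k → ldimQn≤k n k → ldimQn1half≤k n k)
    × (∃[ C ] ∃[ N ] ∀ n → N ≤ n →
    ∀ k → ldimQn1half≤k n k →
    n * ⌊log₂ n ⌋ ≤ k * (⌊log₂ n ⌋ * ⌊log₂ n ⌋) + C * n * ⌊log₂ ⌊log₂ n ⌋ ⌋)
corollary7 = subposet-bound , 6 , 4 , asymptotic-bound
  where
  open Estimates
  -- Q_n^{1,⌊n/2⌋} is an induced subposet of Q_n.
  subposet-bound : ∀ n k → ldimQn≤k n k → ldimQn1half≤k n k
  subposet-bound n k = Restriction.restrict-ldim _≟S_ _⊆_ levels1Half? (λ _ → tt)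
  asymptotic-bound : ∀ n → 4 ≤ n → ∀ k → ldimQn1half≤k n k →
    n * ⌊log₂ n ⌋ ≤ k * (⌊log₂ n ⌋ * ⌊log₂ n ⌋) + 6 * n * ⌊log₂ ⌊log₂ n ⌋ ⌋
  asymptotic-bound n 4≤n k (ℒ , realiser , μ≤k) =
    rearranged-bound n k 4≤n (exponent-bound n k
      (sparse-binomial-bound n k weights middle-binomial≤sparseCount weights-sum))
    where open MiddleLevelEncoding realiser μ≤k (⌊n/2⌋-mono 4≤n)
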